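{- Let $H$ be a $4$-graph and let $\mathcal{H}$ be an expansion of $H$ (as defined in the context). Then $\alpha(\mathcal{H}) \le \alpha(H)+1$.
   Context: A $4$-graph $H=(V(H),E(H))$ has a finite vertex set and edges which are $4$-element subsets of $V(H)$; a vertex set is independent if it contains no edge, and $\alpha(H)$ is the maximum size of an independent set. For $U\subseteq V(H)$, $H-U$ denotes the subgraph induced by $V(H)\setminus U$. A set $U\subseteq V(H)$ is critical if $\alpha(H-U)<\alpha(H)$. Expansion: For each $w\in V(H)$ choose two critical subsets $I_w^0, I_w^1$ (not necessarily distinct), neither containing $w$. Let $d(w)=1$ if $\alpha(H-(I_w^0\cup I_w^1))\le \alpha(H)-2$ and $d(w)=0$ otherwise. Choose pairwise disjoint finite sets $V_w$, $w\in V(H)$, and a $4$-graph $(V_w,E_w)$ with a function $i$ on $3$-subsets of $V_w$ as follows. If $d(w)=0$, $E_w$ is the set of all $4$-subsets of $V_w$ and $i(a,b,c)=0$ for every triple. If $d(w)=1$, partition $V_w=X_w\cup Y_w$ with $X_w=\{x_1,\dots,x_p\}$, $Y_w=\{y_1,\dots,y_q\}$, take a $p\times q$ matrix $(a_{jk})$ with entries in $\{0,1\}$, and let $E_w$ consist of all $4$-subsets of $X_w$, all $4$-subsets of $Y_w$, and all $\{x_j,x_l,y_k,y_s\}$ ($j\ne l$, $k\ne s$) with $a_{jk}+a_{js}+a_{lk}+a_{ls}$ even; for a triple $\{a,b,c\}\subseteq V_w$ set $i(a,b,c)=0$ if it contains an even number of elements of $X_w$ and $i(a,b,c)=1$ otherwise.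 The expansion $\mathcal{H}$ has vertex set $\bigcup_{w} V_w$ and edge set $E_{1111}\cup E_{22}\cup E_{31}\cup\bigcup_w E_w$, where $E_{1111}$ consists of all $\{a,b,c,d\}$ with $a\in V_w,b\in V_x,c\in V_y,d\in V_z$ for some edge $\{w,x,y,z\}\in E(H)$; $E_{22}$ consists of all $\{a,b,c,d\}$ with $\{a,b\}\subseteq V_x$, $\{c,d\}\subseteq V_y$ for some two distinct $x,y\in V(H)$; and $E_{31}$ consists of all $\{a,b,c,d\}$ with $\{a,b,c\}\subseteq V_w$ and $d\in V_x$ for some $w\in V(H)$ and some $x\in I_w^{i(a,b,c)}$. -}

module Defs where

open import Data.Nat using (ℕ; _≤_; _<_; _+_)
open import Data.Bool using (Bool; true; false; _xor_; if_then_else_)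
open import Data.Fin using (Fin)
open import Data.Fin.Subset using (Subset; ⁅_⁆; _∪_; _∈_; _∉_; _⊆_; ∁; ∣_∣)
import Data.Fin.Subset as Sub
open import Data.Product using (Σ; _×_; ∃; proj₁)
open import Data.Sum using (_⊎_)
open import Relation.Binary.PropositionalEquality using (_≡_; _≢_)
open import Relation.Nullary using (¬_)
open import Function.Bundles using (_⇔_)

quad : ∀ {n} → Fin n → Fin n → Fin n → Fin n → Subset n
quad a b c d = ⁅ a ⁆ ∪ ⁅ b ⁆ ∪ ⁅ c ⁆ ∪ ⁅ d ⁆

record Graph4 (n : ℕ) : Set₁ where
  field
    Edge      : Subset n → Set
    edge-size : ∀ e → Edge e → ∣ e ∣ ≡ 4
open Graph4 public

Independent : ∀ {n} → Graph4 n → Subset n → Set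
Independent H S = ∀ e → Edge H e → ¬ (e ⊆ S)

-- Independent sets of the induced subgraph H - U are exactly the
-- independent sets of H contained in V(H) \ U.
IndepMinus : ∀ {n} → Graph4 n → Subset n → Subset n → Set
IndepMinus H U S = S ⊆ ∁ U × Independent H S

IsAlphaMinus : ∀ {n} → Graph4 n → Subset n → ℕ → Set
IsAlphaMinus H U k =
  (Σ (Subset _) λ S → IndepMinus H U S × ∣ S ∣ ≡ k)
  × (∀ S → IndepMinus H U S → ∣ S ∣ ≤ k)

IsAlpha : ∀ {n} → Graph4 n → ℕ → Set
IsAlpha {n} H k =
  (Σ (Subset n) λ S → Independent H S × ∣ S ∣ ≡ k)
  × (∀ S → Independent H S → ∣ S ∣ ≤ k)

Critical : ∀ {n} → Graph4 n → Subset n → Set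
Critical H U = ∀ a b → IsAlpha H a → IsAlphaMinus H U b → b < a

-- α(H - U) ≤ α(H) - 2   (integer subtraction, i.e. α(H - U) + 2 ≤ α(H))
DropsTwo : ∀ {n} → Graph4 n → Subset n → Set
DropsTwo H U = ∀ a b → IsAlpha H a → IsAlphaMinus H U b → b + 2 ≤ a

-- Vertices of the expansion are Fin N;
-- part v = w means v ∈ V_w (so the V_w are pairwise disjoint, possibly empty).
-- I w false = I_w^0, I w true = I_w^1.  d w = true means d(w) = 1.
-- side v = true means v ∈ X_w, false means v ∈ Y_w (only relevant if d(w)=1).
-- mat x y is the matrix entry a_{jk} for x = x_j, y = y_k.
record Expansion {n : ℕ} (H : Graph4 n) : Set₁ where
  field
    N      : ℕ
    part   : Fin N → Fin n
    I      : Fin n → Bool → Subset n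
    I-crit : ∀ w i → Critical H (I w i)
    I-out  : ∀ w i → w ∉ I w i
    d      : Fin n → Bool
    d-spec : ∀ w → (d w ≡ true) ⇔ DropsTwo H (I w false ∪ I w true)
    side   : Fin N → Bool
    mat    : Fin N → Fin N → Bool

  -- i(a,b,c) for a triple inside V_w (true = 1: odd number of elements of X_w)
  iFun : Fin n → Fin N → Fin N → Fin N → Bool
  iFun w a b c = if d w then (side a xor side b xor side c) else false

  -- {a,b,c,d'} ∈ E_w  (all four assumed in V_w)
  InnerEdge : Fin n → Fin N → Fin N → Fin N → Fin N → Set
  InnerEdge w a b c d' =
    d w ≡ false
    ⊎ (d w ≡ true ×
        ((side a ≡ true × side b ≡ true × side c ≡ true × side d' ≡ true)
        ⊎ (side a ≡ false × side b ≡ false × side c ≡ false × side d' ≡ false)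
        ⊎ (side a ≡ true × side b ≡ true × side c ≡ false × side d' ≡ false
           × (mat a c xor mat a d' xor mat b c xor mat b d') ≡ false)))

  EdgeKind : Fin N → Fin N → Fin N → Fin N → Set
  EdgeKind a b c d' =
    -- E_1111
    Edge H (quad (part a) (part b) (part c) (part d'))
    -- E_22
    ⊎ (part a ≡ part b × part c ≡ part d' × part a ≢ part c)
    -- E_31
    ⊎ (part a ≡ part b × part a ≡ part c
       × part d' ∈ I (part a) (iFun (part a) a b c))
    -- E_w
    ⊎ (part a ≡ part b × part a ≡ part c × part a ≡ part d'
       × InnerEdge (part a) a b c d')

  ExpEdge : Subset N → Set
  ExpEdge e = ∣ e ∣ ≡ 4 × Σ (Fin N) λ a → Σ (Fin N) λ b → Σ (Fin N) λ c →
    Σ (Fin N) λ d' → e ≡ quad a b c d' × EdgeKind a b c d'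

  graph : Graph4 N
  graph = record { Edge = ExpEdge ; edge-size = λ e p → proj₁ p }
open Expansion public

module Submission where

-- Let S be independent in the expansion and T ⊆ V(H) the set of parts it meets; T is
-- independent in H because of E_1111, so |T| ≤ α(H).  By E_22 at most one part V_w holds
-- two or more vertices of S, and the other vertices of S are then spread injectively over
-- T ∖ {w}.  If V_w holds three vertices of S, E_31 forces T to avoid one of the critical
-- sets I_w^i, so |T| < α(H).  Four vertices force d(w) = 1 (E_w is complete otherwise),
-- and since not all four lie on one side, two of their triples have different parities,
-- so T avoids I_w^0 ∪ I_w^1 and |T| ≤ α(H) - 2.  Five are impossible: a side can hold at
-- most three, and with a 2 + 3 split two columns (or rows) of the matrix have equal
-- parity, which yields an edge of E_w.  So |S ∩ V_w| + |T| ≤ α(H) + 2 in every case, while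
-- |S| ≤ |S ∩ V_w| + |T| - 1.

open import Defs

open import Data.Bool using (Bool; true; false; not; _xor_)
open import Data.Bool.Properties
  using (¬-not; not-distribˡ-xor; not-distribʳ-xor; xor-assoc; xor-comm; xor-same)
  renaming (_≟_ to _≟ᵇ_)
open import Data.Empty using (⊥; ⊥-elim)
open import Data.Fin using (Fin; zero; suc)
open import Data.Fin.Properties using (any?; suc-injective) renaming (_≟_ to _≟ᶠ_)
open import Data.Fin.Subset hiding (⊥)
open import Data.Fin.Subset using () renaming (⊥ to ∅)
open import Data.Fin.Subset.Properties
open import Data.Nat using (ℕ; zero; suc; _≤_; _<_; _+_; z≤n; s≤s; s≤s⁻¹; _≤?_; _<?_)
open import Data.Nat.Properties
  using (≤-refl; ≤-trans; ≤-reflexive; <⇒≤; <⇒≱; ≮⇒≥; +-suc; +-comm; +-monoʳ-≤; +-monoˡ-≤;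
         m≤n+m; m≤m+n; n≤1+n; m≤n⇒m≤1+n; module ≤-Reasoning)
open import Data.Product using (∃; ∃₂; _×_; _,_; proj₁; proj₂)
open import Data.Sum using (_⊎_; inj₁; inj₂)
open import Data.Vec using ([]; _∷_; tabulate; here; there)
open import Data.Vec.Properties using (lookup∘tabulate; []=⇒lookup; lookup⇒[]=)
open import Function.Base using (case_of_)
open import Function.Bundles using (Equivalence)
open import Relation.Binary.PropositionalEquality
open import Relation.Nullary using (¬_; Dec; yes; no; does; contradiction)
open import Relation.Nullary.Decidable using (_×-dec_; ¬?; decidable-stable; dec-true; dec-false)
open import Relation.Unary using (Decidable)

private variable
  m n : ℕ

-- Finite subsets

x∈p⇒∣p∣≡1+∣p-x∣ : ∀ {x : Fin n} {p} → x ∈ p → ∣ p ∣ ≡ suc ∣ p - x ∣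
x∈p⇒∣p∣≡1+∣p-x∣ {x = zero}  {inside ∷ p}  here      = cong suc (cong ∣_∣ (sym (p─⊥≡p p)))
x∈p⇒∣p∣≡1+∣p-x∣ {x = suc x} {inside ∷ p}  (there h) = cong suc (x∈p⇒∣p∣≡1+∣p-x∣ h)
x∈p⇒∣p∣≡1+∣p-x∣ {x = suc x} {outside ∷ p} (there h) = x∈p⇒∣p∣≡1+∣p-x∣ h

x∉p⇒∣⁅x⁆∪p∣≡1+∣p∣ : ∀ {x : Fin n} {p} → x ∉ p → ∣ ⁅ x ⁆ ∪ p ∣ ≡ suc ∣ p ∣
x∉p⇒∣⁅x⁆∪p∣≡1+∣p∣ {x = zero}  {inside ∷ p}  x∉p = contradiction here x∉p
x∉p⇒∣⁅x⁆∪p∣≡1+∣p∣ {x = zero}  {outside ∷ p} x∉p = cong suc (cong ∣_∣ (∪-identityˡ p))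
x∉p⇒∣⁅x⁆∪p∣≡1+∣p∣ {x = suc x} {inside ∷ p}  x∉p = cong suc (x∉p⇒∣⁅x⁆∪p∣≡1+∣p∣ (λ h → x∉p (there h)))
x∉p⇒∣⁅x⁆∪p∣≡1+∣p∣ {x = suc x} {outside ∷ p} x∉p = x∉p⇒∣⁅x⁆∪p∣≡1+∣p∣ (λ h → x∉p (there h))

∣p∣≡∣p∩q∣+∣p∩∁q∣ : ∀ (p q : Subset n) → ∣ p ∣ ≡ ∣ p ∩ q ∣ + ∣ p ∩ ∁ q ∣
∣p∣≡∣p∩q∣+∣p∩∁q∣ []            []            = refl
∣p∣≡∣p∩q∣+∣p∩∁q∣ (inside ∷ p)  (inside ∷ q)  = cong suc (∣p∣≡∣p∩q∣+∣p∩∁q∣ p q)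
∣p∣≡∣p∩q∣+∣p∩∁q∣ (inside ∷ p)  (outside ∷ q) =
  trans (cong suc (∣p∣≡∣p∩q∣+∣p∩∁q∣ p q)) (sym (+-suc _ _))
∣p∣≡∣p∩q∣+∣p∩∁q∣ (outside ∷ p) (inside ∷ q)  = ∣p∣≡∣p∩q∣+∣p∩∁q∣ p q
∣p∣≡∣p∩q∣+∣p∩∁q∣ (outside ∷ p) (outside ∷ q) = ∣p∣≡∣p∩q∣+∣p∩∁q∣ p q

x∉p-x : ∀ {x : Fin n} (p : Subset n) → x ∉ p - x
x∉p-x {x = zero}  (s ∷ p) ()
x∉p-x {x = suc x} (s ∷ p) (there h) = x∉p-x p h

x∈p-y⁻ : ∀ {x y : Fin n} {p} → x ∈ p - y → x ∈ p × x ≢ y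
x∈p-y⁻ {p = p} h = p─q⊆p p _ h , λ { refl → x∉p-x p h }

0<∣p∣⇒Nonempty : ∀ {p : Subset n} → 0 < ∣ p ∣ → Nonempty p
0<∣p∣⇒Nonempty {p = inside ∷ p}  _     = zero , here
0<∣p∣⇒Nonempty {p = outside ∷ p} 0<∣p∣ with 0<∣p∣⇒Nonempty {p = p} 0<∣p∣
... | x , x∈p = suc x , there x∈p

⊆∧∣q∣≤∣p∣⇒≡ : ∀ {p q : Subset n} → p ⊆ q → ∣ q ∣ ≤ ∣ p ∣ → p ≡ q
⊆∧∣q∣≤∣p∣⇒≡ {p = p} p⊆q ∣q∣≤∣p∣ = ⊆-antisym p⊆q λ {x} x∈q → decidable-stable (x ∈? p) λ x∉p →
  <⇒≱ (p⊂q⇒∣p∣<∣q∣ (p⊆q , x , x∈q , x∉p)) ∣q∣≤∣p∣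

injective⇒∣p∣≤∣q∣ : (f : Fin m → Fin n) {p : Subset m} {q : Subset n} →
  (∀ {x} → x ∈ p → f x ∈ q) → (∀ {x y} → x ∈ p → y ∈ p → f x ≡ f y → x ≡ y) → ∣ p ∣ ≤ ∣ q ∣
injective⇒∣p∣≤∣q∣ f {[]}          into inj = z≤n
injective⇒∣p∣≤∣q∣ f {outside ∷ p} into inj =
  injective⇒∣p∣≤∣q∣ (λ x → f (suc x)) (λ h → into (there h))
    (λ hx hy e → suc-injective (inj (there hx) (there hy) e))
injective⇒∣p∣≤∣q∣ f {inside ∷ p} {q} into inj =
  subst (suc ∣ p ∣ ≤_) (sym (x∈p⇒∣p∣≡1+∣p-x∣ (into here)))
    (s≤s (injective⇒∣p∣≤∣q∣ (λ x → f (suc x))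
      (λ h → x∈p∧x≢y⇒x∈p-y (into (there h)) λ e → case inj (there h) here e of λ ())
      (λ hx hy e → suc-injective (inj (there hx) (there hy) e))))

toSubset : {P : Fin n → Set} → Decidable P → Subset n
toSubset P? = tabulate (λ x → does (P? x))

∈-toSubset⁺ : ∀ {P : Fin n → Set} (P? : Decidable P) {x} → P x → x ∈ toSubset P?
∈-toSubset⁺ P? {x} Px = lookup⇒[]= x _ (trans (lookup∘tabulate _ x) (dec-true (P? x) Px))

∈-toSubset⁻ : ∀ {P : Fin n → Set} (P? : Decidable P) {x} → x ∈ toSubset P? → P x
∈-toSubset⁻ P? {x} h = decidable-stable (P? x) λ ¬Px →
  case trans (sym (dec-false (P? x) ¬Px)) (trans (sym (lookup∘tabulate _ x)) ([]=⇒lookup h)) of λ ()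

hasPreimage? : (f : Fin m → Fin n) (p : Subset m) → Decidable (λ y → ∃ λ x → x ∈ p × f x ≡ y)
hasPreimage? f p y = any? λ x → (x ∈? p) ×-dec (f x ≟ᶠ y)

image : (Fin m → Fin n) → Subset m → Subset n
image f p = toSubset (hasPreimage? f p)

∈-image⁺ : ∀ (f : Fin m → Fin n) {p x} → x ∈ p → f x ∈ image f p
∈-image⁺ f {p} x∈p = ∈-toSubset⁺ (hasPreimage? f p) (_ , x∈p , refl)

∈-image⁻ : ∀ (f : Fin m → Fin n) {p y} → y ∈ image f p → ∃ λ x → x ∈ p × f x ≡ y
∈-image⁻ f {p} = ∈-toSubset⁻ (hasPreimage? f p)

collision? : (f : Fin m → Fin n) (p : Subset m) →
  Dec (∃₂ λ x y → x ∈ p × y ∈ p × x ≢ y × f x ≡ f y)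
collision? f p = any? λ x → any? λ y →
  (x ∈? p) ×-dec (y ∈? p) ×-dec ¬? (x ≟ᶠ y) ×-dec (f x ≟ᶠ f y)

⊆∁-∪ : ∀ {p q r : Subset n} → p ⊆ ∁ q → p ⊆ ∁ r → p ⊆ ∁ (q ∪ r)
⊆∁-∪ {q = q} {r} p⊆∁q p⊆∁r x∈p = x∉p⇒x∈∁p λ x∈q∪r → case x∈p∪q⁻ q r x∈q∪r of λ where
  (inj₁ x∈q) → x∈∁p⇒x∉p (p⊆∁q x∈p) x∈q
  (inj₂ x∈r) → x∈∁p⇒x∉p (p⊆∁r x∈p) x∈r

record Dist3 (a b c : Fin n) : Set where
  constructor dist3
  field ab : a ≢ b ; ac : a ≢ c ; bc : b ≢ c

record Dist4 (a b c d : Fin n) : Set where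
  constructor dist4
  field ab : a ≢ b ; ac : a ≢ c ; ad : a ≢ d ; bc : b ≢ c ; bd : b ≢ d ; cd : c ≢ d

Dist4-preimage : (f : Fin m → Fin n) {a b c d : Fin m} →
  Dist4 (f a) (f b) (f c) (f d) → Dist4 a b c d
Dist4-preimage f (dist4 ab ac ad bc bd cd) =
  dist4 (λ e → ab (cong f e)) (λ e → ac (cong f e)) (λ e → ad (cong f e))
        (λ e → bc (cong f e)) (λ e → bd (cong f e)) (λ e → cd (cong f e))

pick : ∀ {p : Subset n} {k} → suc k ≤ ∣ p ∣ → ∃ λ x → x ∈ p × k ≤ ∣ p - x ∣
pick {p = p} k<∣p∣ =
  let (x , x∈p) = 0<∣p∣⇒Nonempty (≤-trans (s≤s z≤n) k<∣p∣)
  in x , x∈p , s≤s⁻¹ (subst (_ ≤_) (x∈p⇒∣p∣≡1+∣p-x∣ x∈p) k<∣p∣)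

pick₂ : ∀ {p : Subset n} → 2 ≤ ∣ p ∣ → ∃₂ λ x₁ x₂ → x₁ ∈ p × x₂ ∈ p × x₁ ≢ x₂
pick₂ {p = p} h =
  let (x₁ , x₁∈p , h₁) = pick {p = p} h
      (x₂ , x₂∈ , _)   = pick {p = p - x₁} h₁
      (x₂∈p , x₂≢x₁)   = x∈p-y⁻ {p = p} x₂∈
  in x₁ , x₂ , x₁∈p , x₂∈p , ≢-sym x₂≢x₁

pick₃ : ∀ {p : Subset n} → 3 ≤ ∣ p ∣ →
  ∃₂ λ x₁ x₂ → ∃ λ x₃ → x₁ ∈ p × x₂ ∈ p × x₃ ∈ p × Dist3 x₁ x₂ x₃
pick₃ {p = p} h =
  let (x₁ , x₁∈p , h₁)              = pick {p = p} h
      (x₂ , x₃ , x₂∈ , x₃∈ , x₂≢x₃) = pick₂ {p = p - x₁} h₁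
      (x₂∈p , x₂≢x₁)                = x∈p-y⁻ {p = p} x₂∈
      (x₃∈p , x₃≢x₁)                = x∈p-y⁻ {p = p} x₃∈
  in x₁ , x₂ , x₃ , x₁∈p , x₂∈p , x₃∈p , dist3 (≢-sym x₂≢x₁) (≢-sym x₃≢x₁) x₂≢x₃

pick₄ : ∀ {p : Subset n} → 4 ≤ ∣ p ∣ →
  ∃₂ λ x₁ x₂ → ∃₂ λ x₃ x₄ → x₁ ∈ p × x₂ ∈ p × x₃ ∈ p × x₄ ∈ p × Dist4 x₁ x₂ x₃ x₄
pick₄ {p = p} h =
  let (x₁ , x₁∈p , h₁) = pick {p = p} h
      (x₂ , x₃ , x₄ , x₂∈ , x₃∈ , x₄∈ , dist3 x₂≢x₃ x₂≢x₄ x₃≢x₄) = pick₃ {p = p - x₁} h₁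
      (x₂∈p , x₂≢x₁) = x∈p-y⁻ {p = p} x₂∈
      (x₃∈p , x₃≢x₁) = x∈p-y⁻ {p = p} x₃∈
      (x₄∈p , x₄≢x₁) = x∈p-y⁻ {p = p} x₄∈
  in x₁ , x₂ , x₃ , x₄ , x₁∈p , x₂∈p , x₃∈p , x₄∈p ,
     dist4 (≢-sym x₂≢x₁) (≢-sym x₃≢x₁) (≢-sym x₄≢x₁) x₂≢x₃ x₂≢x₄ x₃≢x₄

∈quad₁ : ∀ {a b c d : Fin n} → a ∈ quad a b c d
∈quad₁ {a = a} = p⊆p∪q _ (x∈⁅x⁆ a)

∈quad₂ : ∀ {a b c d : Fin n} → b ∈ quad a b c d
∈quad₂ {a = a} {b} = q⊆p∪q ⁅ a ⁆ _ (p⊆p∪q _ (x∈⁅x⁆ b))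

∈quad₃ : ∀ {a b c d : Fin n} → c ∈ quad a b c d
∈quad₃ {a = a} {b} {c} = q⊆p∪q ⁅ a ⁆ _ (q⊆p∪q ⁅ b ⁆ _ (p⊆p∪q _ (x∈⁅x⁆ c)))

∈quad₄ : ∀ {a b c d : Fin n} → d ∈ quad a b c d
∈quad₄ {a = a} {b} {c} {d} = q⊆p∪q ⁅ a ⁆ _ (q⊆p∪q ⁅ b ⁆ _ (q⊆p∪q ⁅ c ⁆ _ (x∈⁅x⁆ d)))

quad⊆ : ∀ {a b c d : Fin n} {p} → a ∈ p → b ∈ p → c ∈ p → d ∈ p → quad a b c d ⊆ p
quad⊆ {a = a} {b} {c} {d} a∈p b∈p c∈p d∈p x∈quad
  with x∈p∪q⁻ ⁅ a ⁆ _ x∈quad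
... | inj₁ x∈a rewrite x∈⁅y⁆⇒x≡y a x∈a = a∈p
... | inj₂ x∈bcd with x∈p∪q⁻ ⁅ b ⁆ _ x∈bcd
...   | inj₁ x∈b rewrite x∈⁅y⁆⇒x≡y b x∈b = b∈p
...   | inj₂ x∈cd with x∈p∪q⁻ ⁅ c ⁆ _ x∈cd
...     | inj₁ x∈c rewrite x∈⁅y⁆⇒x≡y c x∈c = c∈p
...     | inj₂ x∈d rewrite x∈⁅y⁆⇒x≡y d x∈d = d∈p

∣quad∣≡4 : ∀ {a b c d : Fin n} → Dist4 a b c d → ∣ quad a b c d ∣ ≡ 4
∣quad∣≡4 {a = a} {b} {c} {d} (dist4 ab ac ad bc bd cd) =
  trans (x∉p⇒∣⁅x⁆∪p∣≡1+∣p∣ a∉bcd) (cong suc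
  (trans (x∉p⇒∣⁅x⁆∪p∣≡1+∣p∣ b∉cd) (cong suc
  (trans (x∉p⇒∣⁅x⁆∪p∣≡1+∣p∣ (x≢y⇒x∉⁅y⁆ cd)) (cong suc (∣⁅x⁆∣≡1 d))))))
  where
  b∉cd : b ∉ ⁅ c ⁆ ∪ ⁅ d ⁆
  b∉cd h = case x∈p∪q⁻ ⁅ c ⁆ ⁅ d ⁆ h of λ where
    (inj₁ b∈c) → bc (x∈⁅y⁆⇒x≡y c b∈c)
    (inj₂ b∈d) → bd (x∈⁅y⁆⇒x≡y d b∈d)
  a∉bcd : a ∉ ⁅ b ⁆ ∪ ⁅ c ⁆ ∪ ⁅ d ⁆
  a∉bcd h = case x∈p∪q⁻ ⁅ b ⁆ _ h of λ where
    (inj₁ a∈b) → ab (x∈⁅y⁆⇒x≡y b a∈b)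
    (inj₂ a∈cd) → case x∈p∪q⁻ ⁅ c ⁆ ⁅ d ⁆ a∈cd of λ where
      (inj₁ a∈c) → ac (x∈⁅y⁆⇒x≡y c a∈c)
      (inj₂ a∈d) → ad (x∈⁅y⁆⇒x≡y d a∈d)

∣e∣≡4⇒quad : ∀ {e : Subset n} → ∣ e ∣ ≡ 4 →
  ∃₂ λ a b → ∃₂ λ c d → Dist4 a b c d × quad a b c d ≡ e
∣e∣≡4⇒quad {e = e} ∣e∣≡4 =
  let (a , b , c , d , a∈e , b∈e , c∈e , d∈e , D) = pick₄ {p = e} (≤-reflexive (sym ∣e∣≡4))
  in a , b , c , d , D ,
     ⊆∧∣q∣≤∣p∣⇒≡ (quad⊆ a∈e b∈e c∈e d∈e) (≤-reflexive (trans ∣e∣≡4 (sym (∣quad∣≡4 D))))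

-- Boolean parity

Bool-cover : (P : Bool → Set) {u : Bool} → P u → P (not u) → ∀ b → P b
Bool-cover P {true}  Pu Pnu true  = Pu
Bool-cover P {true}  Pu Pnu false = Pnu
Bool-cover P {false} Pu Pnu true  = Pnu
Bool-cover P {false} Pu Pnu false = Pu

Bool-pigeonhole : ∀ (b₁ b₂ b₃ : Bool) → b₁ ≡ b₂ ⊎ b₁ ≡ b₃ ⊎ b₂ ≡ b₃
Bool-pigeonhole true  true  _     = inj₁ refl
Bool-pigeonhole false false _     = inj₁ refl
Bool-pigeonhole true  false true  = inj₂ (inj₁ refl)
Bool-pigeonhole true  false false = inj₂ (inj₂ refl)
Bool-pigeonhole false true  true  = inj₂ (inj₂ refl)
Bool-pigeonhole false true  false = inj₂ (inj₁ refl)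

adjacent-≢-or-constant : ∀ σ₁ σ₂ σ₃ σ₄ →
  σ₁ ≢ σ₂ ⊎ σ₂ ≢ σ₃ ⊎ σ₃ ≢ σ₄
  ⊎ (σ₁ ≡ true × σ₂ ≡ true × σ₃ ≡ true × σ₄ ≡ true)
  ⊎ (σ₁ ≡ false × σ₂ ≡ false × σ₃ ≡ false × σ₄ ≡ false)
adjacent-≢-or-constant σ₁ σ₂ σ₃ σ₄ with σ₁ ≟ᵇ σ₂ | σ₂ ≟ᵇ σ₃ | σ₃ ≟ᵇ σ₄
... | no σ₁≢σ₂ | _          | _          = inj₁ σ₁≢σ₂
... | yes _    | no σ₂≢σ₃   | _          = inj₂ (inj₁ σ₂≢σ₃)
... | yes _    | yes _      | no σ₃≢σ₄   = inj₂ (inj₂ (inj₁ σ₃≢σ₄))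
... | yes refl | yes refl   | yes refl with σ₁
...   | true  = inj₂ (inj₂ (inj₂ (inj₁ (refl , refl , refl , refl))))
...   | false = inj₂ (inj₂ (inj₂ (inj₂ (refl , refl , refl , refl))))

xor-congˡ-not : ∀ {x y} z → x ≡ not y → x xor z ≡ not (y xor z)
xor-congˡ-not {y = y} z refl = sym (not-distribˡ-xor y z)

xor-congʳ-not : ∀ x {y z} → y ≡ not z → x xor y ≡ not (x xor z)
xor-congʳ-not x {z = z} refl = sym (not-distribʳ-xor x z)

xor-pairs-cancel : ∀ p q r s → p xor q ≡ r xor s → p xor q xor r xor s ≡ false
xor-pairs-cancel p q r s pq≡rs = begin
  p xor q xor r xor s       ≡⟨ xor-assoc p q (r xor s) ⟨
  (p xor q) xor (r xor s)   ≡⟨ cong (_xor (r xor s)) pq≡rs ⟩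
  (r xor s) xor (r xor s)   ≡⟨ xor-same (r xor s) ⟩
  false                     ∎
  where open ≡-Reasoning

xor-columns-cancel : ∀ p q r s → p xor r ≡ q xor s → p xor q xor r xor s ≡ false
xor-columns-cancel p q r s pr≡qs = trans (cong (p xor_) swap) (xor-pairs-cancel p r q s pr≡qs)
  where
  open ≡-Reasoning
  swap : q xor r xor s ≡ r xor q xor s
  swap = begin
    q xor r xor s     ≡⟨ xor-assoc q r s ⟨
    (q xor r) xor s   ≡⟨ cong (_xor s) (xor-comm q r) ⟩
    (r xor q) xor s   ≡⟨ xor-assoc r q s ⟩
    r xor q xor s     ∎

+≤4-unless-2+3 : ∀ x y → x ≤ 3 → y ≤ 3 → ¬ (2 ≤ x × 3 ≤ y) → ¬ (3 ≤ x × 2 ≤ y) → x + y ≤ 4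
+≤4-unless-2+3 0 y _ y≤3 _   _   = m≤n⇒m≤1+n y≤3
+≤4-unless-2+3 1 y _ y≤3 _   _   = s≤s y≤3
+≤4-unless-2+3 2 y _ _   ¬23 _   = s≤s (s≤s (≮⇒≥ λ 2<y → ¬23 (≤-refl , 2<y)))
+≤4-unless-2+3 3 y _ _   _   ¬32 = s≤s (s≤s (s≤s (≮⇒≥ λ 1<y → ¬32 (≤-refl , 1<y))))
+≤4-unless-2+3 (suc (suc (suc (suc _)))) _ (s≤s (s≤s (s≤s ()))) _ _ _

fiber-slack : ∀ r {t a} → r ≤ 4 → t ≤ a → (3 ≤ r → suc t ≤ a) → (4 ≤ r → t + 2 ≤ a) →
  r + t ≤ 2 + a
fiber-slack 0 _ t≤a _ _ = ≤-trans t≤a (m≤n+m _ 2)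
fiber-slack 1 _ t≤a _ _ = s≤s (≤-trans t≤a (n≤1+n _))
fiber-slack 2 _ t≤a _ _ = s≤s (s≤s t≤a)
fiber-slack 3 _ _ three _ = s≤s (s≤s (three ≤-refl))
fiber-slack 4 {t} {a} _ _ _ four = s≤s (s≤s (subst (_≤ a) (+-comm t 2) (four ≤-refl)))
fiber-slack (suc (suc (suc (suc (suc _))))) (s≤s (s≤s (s≤s (s≤s ())))) _ _ _

+-≤-of-slack : ∀ r {k t a} → k < t → r + t ≤ 2 + a → r + k ≤ a + 1
+-≤-of-slack r {k} {t} {a} k<t r+t≤2+a = subst (r + k ≤_) (+-comm 1 a) (s≤s⁻¹ (begin
  suc (r + k)   ≡⟨ +-suc r k ⟨
  r + suc k     ≤⟨ +-monoʳ-≤ r k<t ⟩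
  r + t         ≤⟨ r+t≤2+a ⟩
  2 + a         ∎))
  where open ≤-Reasoning

-- Independence numbers

¬¬-maximum : (P : ℕ → Set) {m bound : ℕ} → P m → (∀ k → P k → k ≤ bound) →
  ¬ ¬ (∃ λ k → P k × ∀ j → P j → j ≤ k)
¬¬-maximum P {m} {bound} Pm bounded no-max =
  unbounded (suc bound) λ (j , bound<j , Pj) → <⇒≱ bound<j (bounded j Pj)
  where
  unbounded : ∀ t → ¬ ¬ (∃ λ j → t ≤ j × P j)
  unbounded zero    ¬P = ¬P (m , z≤n , Pm)
  unbounded (suc t) ¬P = unbounded t λ (j , t≤j , Pj) →
    no-max (j , Pj , λ i Pi → ≮⇒≥ λ j<i → ¬P (i , ≤-trans (s≤s t≤j) j<i , Pi))

module _ {n} (H : Graph4 n) where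

  ∅-independent : Independent H ∅
  ∅-independent e e∈H e⊆∅ =
    contradiction (subst₂ _≤_ (edge-size H e e∈H) (∣⊥∣≡0 n) (p⊆q⇒∣p∣≤∣q∣ e⊆∅)) λ ()

  -- independence is undecidable, so α(H - U) exists only up to double negation; the
  -- bounds derived from it below are decidable, which is enough
  ¬¬-αMinus : ∀ U → ¬ ¬ ∃ (IsAlphaMinus H U)
  ¬¬-αMinus U no-α = ¬¬-maximum (λ k → ∃ λ S → IndepMinus H U S × ∣ S ∣ ≡ k)
    (∅ , (⊥⊆ , ∅-independent) , ∣⊥∣≡0 n) (λ { _ (S , _ , refl) → ∣p∣≤n S })
    λ (b , max , maximal) → no-α (b , max , λ S S-indep → maximal _ (S , S-indep , refl))

  module _ {a} (α : IsAlpha H a) {T : Subset n} (T-indep : Independent H T) where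

    ¬¬-∣T∣≤αMinus : ∀ {U} → T ⊆ ∁ U → ¬ ¬ ∃ λ b → IsAlphaMinus H U b × ∣ T ∣ ≤ b
    ¬¬-∣T∣≤αMinus T⊆∁U no-b =
      ¬¬-αMinus _ λ (b , αU) → no-b (b , αU , proj₂ αU T (T⊆∁U , T-indep))

    critical⇒∣T∣<α : ∀ {U} → Critical H U → T ⊆ ∁ U → ∣ T ∣ < a
    critical⇒∣T∣<α crit T⊆∁U = decidable-stable (_ <? a) λ ∣T∣≮a →
      ¬¬-∣T∣≤αMinus T⊆∁U λ (b , αU , ∣T∣≤b) → ∣T∣≮a (≤-trans (s≤s ∣T∣≤b) (crit a b α αU))

    dropsTwo⇒∣T∣+2≤α : ∀ {U} → DropsTwo H U → T ⊆ ∁ U → ∣ T ∣ + 2 ≤ a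
    dropsTwo⇒∣T∣+2≤α drops T⊆∁U = decidable-stable (_ ≤? a) λ ∣T∣+2≰a →
      ¬¬-∣T∣≤αMinus T⊆∁U λ (b , αU , ∣T∣≤b) →
        ∣T∣+2≰a (≤-trans (+-monoˡ-≤ 2 ∣T∣≤b) (drops a b α αU))

-- Independent sets of an expansion

module _ {n} {H : Graph4 n} (X : Expansion H) {S : Subset (N X)}
         (S-indep : Independent (graph X) S) where

  T : Subset n
  T = image (part X) S

  inPart? : ∀ w → Decidable (λ x → part X x ≡ w)
  inPart? w x = part X x ≟ᶠ w

  V : Fin n → Subset (N X)
  V w = toSubset (inPart? w)

  S∩V : Fin n → Subset (N X)
  S∩V w = S ∩ V w

  ∈S∩V⁺ : ∀ {w x} → x ∈ S → part X x ≡ w → x ∈ S∩V w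
  ∈S∩V⁺ {w} x∈S px≡w = x∈p∩q⁺ (x∈S , ∈-toSubset⁺ (inPart? w) px≡w)

  ∈S∩V⁻ : ∀ {w x} → x ∈ S∩V w → x ∈ S × part X x ≡ w
  ∈S∩V⁻ {w} h with x∈p∩q⁻ S _ h
  ... | x∈S , x∈V = x∈S , ∈-toSubset⁻ (inPart? w) x∈V

  ∈S∖V⁻ : ∀ {w x} → x ∈ S ∩ ∁ (V w) → x ∈ S × part X x ≢ w
  ∈S∖V⁻ {w} h with x∈p∩q⁻ S _ h
  ... | x∈S , x∈∁V = x∈S , λ px≡w → x∈∁p⇒x∉p x∈∁V (∈-toSubset⁺ (inPart? w) px≡w)

  ≢-by-part : ∀ {x y w} → part X x ≡ w → part X y ≢ w → x ≢ y
  ≢-by-part px≡w py≢w refl = py≢w px≡w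

  no-edge : ∀ {x₁ x₂ x₃ x₄} → Dist4 x₁ x₂ x₃ x₄ → x₁ ∈ S → x₂ ∈ S → x₃ ∈ S → x₄ ∈ S →
    ¬ EdgeKind X x₁ x₂ x₃ x₄
  no-edge D h₁ h₂ h₃ h₄ kind =
    S-indep _ (∣quad∣≡4 D , _ , _ , _ , _ , refl , kind) (quad⊆ h₁ h₂ h₃ h₄)

  T-independent : Independent H T
  T-independent e e∈H e⊆T =
    let (w₁ , w₂ , w₃ , w₄ , D , quad≡e) = ∣e∣≡4⇒quad (edge-size H e e∈H)
        preimage : ∀ {w} → w ∈ quad w₁ w₂ w₃ w₄ → Preimage w
        preimage w∈quad = ∈-image⁻ (part X) (e⊆T (subst (_ ∈_) quad≡e w∈quad))
    in lift D (subst (Edge H) (sym quad≡e) e∈H)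
         (preimage ∈quad₁) (preimage ∈quad₂) (preimage ∈quad₃) (preimage ∈quad₄)
    where
    Preimage : Fin n → Set
    Preimage w = ∃ λ x → x ∈ S × part X x ≡ w
    lift : ∀ {w₁ w₂ w₃ w₄} → Dist4 w₁ w₂ w₃ w₄ → Edge H (quad w₁ w₂ w₃ w₄) →
      Preimage w₁ → Preimage w₂ → Preimage w₃ → ¬ Preimage w₄
    lift D e∈H (_ , h₁ , refl) (_ , h₂ , refl) (_ , h₃ , refl) (_ , h₄ , refl) =
      no-edge (Dist4-preimage (part X) D) h₁ h₂ h₃ h₄ (inj₁ e∈H)

  ∣S∖V∣<∣T∣ : ∀ {w s₁ s₂} → s₁ ≢ s₂ → s₁ ∈ S∩V w → s₂ ∈ S∩V w → ∣ S ∩ ∁ (V w) ∣ < ∣ T ∣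
  ∣S∖V∣<∣T∣ {w} {s₁} {s₂} s₁≢s₂ h₁ h₂ with ∈S∩V⁻ h₁ | ∈S∩V⁻ h₂
  ... | s₁∈S , ps₁≡w | s₂∈S , ps₂≡w = begin
    suc ∣ S ∩ ∁ (V w) ∣   ≤⟨ s≤s (injective⇒∣p∣≤∣q∣ (part X) into injective) ⟩
    suc ∣ T - w ∣         ≡⟨ x∈p⇒∣p∣≡1+∣p-x∣ w∈T ⟨
    ∣ T ∣                 ∎
    where
    open ≤-Reasoning
    w∈T : w ∈ T
    w∈T = subst (_∈ T) ps₁≡w (∈-image⁺ (part X) s₁∈S)
    into : ∀ {x} → x ∈ S ∩ ∁ (V w) → part X x ∈ T - w
    into h with ∈S∖V⁻ h
    ... | x∈S , px≢w = x∈p∧x≢y⇒x∈p-y (∈-image⁺ (part X) x∈S) px≢w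
    -- two vertices outside V_w in one part would form an E_22-edge with s₁, s₂
    injective : ∀ {x y} → x ∈ S ∩ ∁ (V w) → y ∈ S ∩ ∁ (V w) → part X x ≡ part X y → x ≡ y
    injective {x} {y} hx hy px≡py with ∈S∖V⁻ hx | ∈S∖V⁻ hy
    ... | x∈S , px≢w | y∈S , py≢w = decidable-stable (x ≟ᶠ y) λ x≢y →
      no-edge (dist4 s₁≢s₂ (≢-by-part ps₁≡w px≢w) (≢-by-part ps₁≡w py≢w)
                     (≢-by-part ps₂≡w px≢w) (≢-by-part ps₂≡w py≢w) x≢y)
        s₁∈S s₂∈S x∈S y∈S
        (inj₂ (inj₁ (trans ps₁≡w (sym ps₂≡w) , px≡py , λ ps₁≡px → px≢w (trans (sym ps₁≡px) ps₁≡w))))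

  triple-avoids : ∀ {w c₁ c₂ c₃} → Dist3 c₁ c₂ c₃ → c₁ ∈ S∩V w → c₂ ∈ S∩V w → c₃ ∈ S∩V w →
    T ⊆ ∁ (I X w (iFun X w c₁ c₂ c₃))
  triple-avoids {c₁ = c₁} {c₂} {c₃} (dist3 c₁≢c₂ c₁≢c₃ c₂≢c₃) h₁ h₂ h₃ z∈T
    with ∈S∩V⁻ h₁ | ∈S∩V⁻ h₂ | ∈S∩V⁻ h₃ | ∈-image⁻ (part X) z∈T
  ... | c₁∈S , refl | c₂∈S , pc₂≡w | c₃∈S , pc₃≡w | y , y∈S , refl = x∉p⇒x∈∁p λ py∈I →
    let i = iFun X (part X c₁) c₁ c₂ c₃
        py≢w : part X y ≢ part X c₁
        py≢w py≡w = I-out X (part X c₁) i (subst (_∈ I X (part X c₁) i) py≡w py∈I)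
    in
    no-edge (dist4 c₁≢c₂ c₁≢c₃ (≢-by-part refl py≢w) c₂≢c₃
                   (≢-by-part pc₂≡w py≢w) (≢-by-part pc₃≡w py≢w))
      c₁∈S c₂∈S c₃∈S y∈S (inj₂ (inj₂ (inj₁ (sym pc₂≡w , sym pc₃≡w , py∈I))))

  no-inner-edge : ∀ {w c₁ c₂ c₃ c₄} → Dist4 c₁ c₂ c₃ c₄ →
    c₁ ∈ S∩V w → c₂ ∈ S∩V w → c₃ ∈ S∩V w → c₄ ∈ S∩V w → ¬ InnerEdge X w c₁ c₂ c₃ c₄
  no-inner-edge D h₁ h₂ h₃ h₄ inner with ∈S∩V⁻ h₁ | ∈S∩V⁻ h₂ | ∈S∩V⁻ h₃ | ∈S∩V⁻ h₄
  ... | c₁∈S , refl | c₂∈S , pc₂≡w | c₃∈S , pc₃≡w | c₄∈S , pc₄≡w =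
    no-edge D c₁∈S c₂∈S c₃∈S c₄∈S (inj₂ (inj₂ (inj₂ (sym pc₂≡w , sym pc₃≡w , sym pc₄≡w , inner))))

  iFun-of-d≡true : ∀ {w} → d X w ≡ true → ∀ x y z →
    iFun X w x y z ≡ (side X x xor side X y xor side X z)
  iFun-of-d≡true d≡true x y z rewrite d≡true = refl

  quadruple⇒dropsTwo : ∀ {w c₁ c₂ c₃ c₄} → Dist4 c₁ c₂ c₃ c₄ →
    c₁ ∈ S∩V w → c₂ ∈ S∩V w → c₃ ∈ S∩V w → c₄ ∈ S∩V w →
    d X w ≡ true × T ⊆ ∁ (I X w false ∪ I X w true)
  quadruple⇒dropsTwo {w} {c₁} {c₂} {c₃} {c₄} D h₁ h₂ h₃ h₄ with d X w in d≡
  ... | false = ⊥-elim (no-inner-edge D h₁ h₂ h₃ h₄ (inj₁ d≡))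
  ... | true  = refl , by-sides (adjacent-≢-or-constant σ₁ σ₂ σ₃ σ₄)
    where
    open Dist4 D
    σ₁ σ₂ σ₃ σ₄ : Bool
    σ₁ = side X c₁
    σ₂ = side X c₂
    σ₃ = side X c₃
    σ₄ = side X c₄
    Avoids : Bool → Set
    Avoids β = T ⊆ ∁ (I X w β)
    avoids₃ : ∀ {x y z} → Dist3 x y z → x ∈ S∩V w → y ∈ S∩V w → z ∈ S∩V w →
      Avoids (side X x xor side X y xor side X z)
    avoids₃ {x} {y} {z} D₃ hx hy hz = subst Avoids (iFun-of-d≡true d≡ x y z) (triple-avoids D₃ hx hy hz)
    avoids-both : ∀ {u v} → v ≡ not u → Avoids u → Avoids v → T ⊆ ∁ (I X w false ∪ I X w true)
    avoids-both refl Au Av = ⊆∁-∪ (Bool-cover Avoids Au Av false) (Bool-cover Avoids Au Av true)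
    -- two sides differ, so two of the triples in {c₁,c₂,c₃,c₄} have different i-values
    by-sides : σ₁ ≢ σ₂ ⊎ σ₂ ≢ σ₃ ⊎ σ₃ ≢ σ₄
      ⊎ (σ₁ ≡ true × σ₂ ≡ true × σ₃ ≡ true × σ₄ ≡ true)
      ⊎ (σ₁ ≡ false × σ₂ ≡ false × σ₃ ≡ false × σ₄ ≡ false) → T ⊆ ∁ (I X w false ∪ I X w true)
    by-sides (inj₁ σ₁≢σ₂) =
      avoids-both (xor-congˡ-not (σ₃ xor σ₄) (¬-not σ₁≢σ₂))
        (avoids₃ (dist3 bc bd cd) h₂ h₃ h₄) (avoids₃ (dist3 ac ad cd) h₁ h₃ h₄)
    by-sides (inj₂ (inj₁ σ₂≢σ₃)) =
      avoids-both (xor-congʳ-not σ₁ (xor-congˡ-not σ₄ (¬-not (≢-sym σ₂≢σ₃))))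
        (avoids₃ (dist3 ab ad bd) h₁ h₂ h₄) (avoids₃ (dist3 ac ad cd) h₁ h₃ h₄)
    by-sides (inj₂ (inj₂ (inj₁ σ₃≢σ₄))) =
      avoids-both (xor-congʳ-not σ₁ (xor-congʳ-not σ₂ (¬-not (≢-sym σ₃≢σ₄))))
        (avoids₃ (dist3 ab ac bc) h₁ h₂ h₃) (avoids₃ (dist3 ab ad bd) h₁ h₂ h₄)
    by-sides (inj₂ (inj₂ (inj₂ (inj₁ all-X)))) =
      ⊥-elim (no-inner-edge D h₁ h₂ h₃ h₄ (inj₂ (d≡ , inj₁ all-X)))
    by-sides (inj₂ (inj₂ (inj₂ (inj₂ all-Y)))) =
      ⊥-elim (no-inner-edge D h₁ h₂ h₃ h₄ (inj₂ (d≡ , inj₂ (inj₁ all-Y))))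

  module _ {w} (d≡true : d X w ≡ true) where

    onX? : Decidable (λ x → side X x ≡ true)
    onX? x = side X x ≟ᵇ true

    X-side : Subset (N X)
    X-side = toSubset onX?

    S∩X S∩Y : Subset (N X)
    S∩X = S∩V w ∩ X-side
    S∩Y = S∩V w ∩ ∁ X-side

    ∈S∩X⁻ : ∀ {x} → x ∈ S∩X → x ∈ S∩V w × side X x ≡ true
    ∈S∩X⁻ h with x∈p∩q⁻ (S∩V w) _ h
    ... | x∈S∩V , x∈X = x∈S∩V , ∈-toSubset⁻ onX? x∈X

    ∈S∩Y⁻ : ∀ {x} → x ∈ S∩Y → x ∈ S∩V w × side X x ≡ false
    ∈S∩Y⁻ h with x∈p∩q⁻ (S∩V w) _ h
    ... | x∈S∩V , x∉X = x∈S∩V , ¬-not λ sx≡true → x∈∁p⇒x∉p x∉X (∈-toSubset⁺ onX? sx≡true)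

    S∩X-S∩Y-disjoint : ∀ {x y} → x ∈ S∩X → y ∈ S∩Y → x ≢ y
    S∩X-S∩Y-disjoint hx hy refl with trans (sym (proj₂ (∈S∩X⁻ hx))) (proj₂ (∈S∩Y⁻ hy))
    ... | ()

    no-four-in-S∩X : ∀ {x₁ x₂ x₃ x₄} → Dist4 x₁ x₂ x₃ x₄ →
      x₁ ∈ S∩X → x₂ ∈ S∩X → x₃ ∈ S∩X → x₄ ∈ S∩X → ⊥
    no-four-in-S∩X D h₁ h₂ h₃ h₄ with ∈S∩X⁻ h₁ | ∈S∩X⁻ h₂ | ∈S∩X⁻ h₃ | ∈S∩X⁻ h₄
    ... | v₁ , s₁ | v₂ , s₂ | v₃ , s₃ | v₄ , s₄ =
      no-inner-edge D v₁ v₂ v₃ v₄ (inj₂ (d≡true , inj₁ (s₁ , s₂ , s₃ , s₄)))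

    no-four-in-S∩Y : ∀ {y₁ y₂ y₃ y₄} → Dist4 y₁ y₂ y₃ y₄ →
      y₁ ∈ S∩Y → y₂ ∈ S∩Y → y₃ ∈ S∩Y → y₄ ∈ S∩Y → ⊥
    no-four-in-S∩Y D h₁ h₂ h₃ h₄ with ∈S∩Y⁻ h₁ | ∈S∩Y⁻ h₂ | ∈S∩Y⁻ h₃ | ∈S∩Y⁻ h₄
    ... | v₁ , s₁ | v₂ , s₂ | v₃ , s₃ | v₄ , s₄ =
      no-inner-edge D v₁ v₂ v₃ v₄ (inj₂ (d≡true , inj₂ (inj₁ (s₁ , s₂ , s₃ , s₄))))

    no-even-square : ∀ {x₁ x₂ y₁ y₂} → x₁ ≢ x₂ → y₁ ≢ y₂ →
      x₁ ∈ S∩X → x₂ ∈ S∩X → y₁ ∈ S∩Y → y₂ ∈ S∩Y →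
      (mat X x₁ y₁ xor mat X x₁ y₂ xor mat X x₂ y₁ xor mat X x₂ y₂) ≢ false
    no-even-square x₁≢x₂ y₁≢y₂ h₁ h₂ h₃ h₄ even
      with ∈S∩X⁻ h₁ | ∈S∩X⁻ h₂ | ∈S∩Y⁻ h₃ | ∈S∩Y⁻ h₄
    ... | v₁ , s₁ | v₂ , s₂ | v₃ , s₃ | v₄ , s₄ =
      no-inner-edge
        (dist4 x₁≢x₂ (S∩X-S∩Y-disjoint h₁ h₃) (S∩X-S∩Y-disjoint h₁ h₄)
               (S∩X-S∩Y-disjoint h₂ h₃) (S∩X-S∩Y-disjoint h₂ h₄) y₁≢y₂)
        v₁ v₂ v₃ v₄ (inj₂ (d≡true , inj₂ (inj₂ (s₁ , s₂ , s₃ , s₄ , even))))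

    ∣S∩X∣≤3 : ∣ S∩X ∣ ≤ 3
    ∣S∩X∣≤3 = ≮⇒≥ λ 3<∣S∩X∣ → case pick₄ 3<∣S∩X∣ of λ
      (_ , _ , _ , _ , h₁ , h₂ , h₃ , h₄ , D) → no-four-in-S∩X D h₁ h₂ h₃ h₄

    ∣S∩Y∣≤3 : ∣ S∩Y ∣ ≤ 3
    ∣S∩Y∣≤3 = ≮⇒≥ λ 3<∣S∩Y∣ → case pick₄ 3<∣S∩Y∣ of λ
      (_ , _ , _ , _ , h₁ , h₂ , h₃ , h₄ , D) → no-four-in-S∩Y D h₁ h₂ h₃ h₄

    ¬2×3 : ¬ (2 ≤ ∣ S∩X ∣ × 3 ≤ ∣ S∩Y ∣)
    ¬2×3 (2≤∣S∩X∣ , 3≤∣S∩Y∣) =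
      let (x₁ , x₂ , h₁ , h₂ , x₁≢x₂) = pick₂ {p = S∩X} 2≤∣S∩X∣
          (y₁ , y₂ , y₃ , k₁ , k₂ , k₃ , dist3 y₁≢y₂ y₁≢y₃ y₂≢y₃) = pick₃ {p = S∩Y} 3≤∣S∩Y∣
          column : Fin (N X) → Bool
          column y = mat X x₁ y xor mat X x₂ y
          equal-columns : ∀ {y y′} → y ≢ y′ → y ∈ S∩Y → y′ ∈ S∩Y → column y ≢ column y′
          equal-columns {y} {y′} y≢y′ k k′ c≡c′ = no-even-square x₁≢x₂ y≢y′ h₁ h₂ k k′
            (xor-columns-cancel (mat X x₁ y) (mat X x₁ y′) (mat X x₂ y) (mat X x₂ y′) c≡c′)
      in case Bool-pigeonhole (column y₁) (column y₂) (column y₃) of λ where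
           (inj₁ c₁≡c₂)        → equal-columns y₁≢y₂ k₁ k₂ c₁≡c₂
           (inj₂ (inj₁ c₁≡c₃)) → equal-columns y₁≢y₃ k₁ k₃ c₁≡c₃
           (inj₂ (inj₂ c₂≡c₃)) → equal-columns y₂≢y₃ k₂ k₃ c₂≡c₃

    ¬3×2 : ¬ (3 ≤ ∣ S∩X ∣ × 2 ≤ ∣ S∩Y ∣)
    ¬3×2 (3≤∣S∩X∣ , 2≤∣S∩Y∣) =
      let (x₁ , x₂ , x₃ , h₁ , h₂ , h₃ , dist3 x₁≢x₂ x₁≢x₃ x₂≢x₃) = pick₃ {p = S∩X} 3≤∣S∩X∣
          (y₁ , y₂ , k₁ , k₂ , y₁≢y₂) = pick₂ {p = S∩Y} 2≤∣S∩Y∣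
          row : Fin (N X) → Bool
          row x = mat X x y₁ xor mat X x y₂
          equal-rows : ∀ {x x′} → x ≢ x′ → x ∈ S∩X → x′ ∈ S∩X → row x ≢ row x′
          equal-rows {x} {x′} x≢x′ h h′ r≡r′ = no-even-square x≢x′ y₁≢y₂ h h′ k₁ k₂
            (xor-pairs-cancel (mat X x y₁) (mat X x y₂) (mat X x′ y₁) (mat X x′ y₂) r≡r′)
      in case Bool-pigeonhole (row x₁) (row x₂) (row x₃) of λ where
           (inj₁ r₁≡r₂)        → equal-rows x₁≢x₂ h₁ h₂ r₁≡r₂
           (inj₂ (inj₁ r₁≡r₃)) → equal-rows x₁≢x₃ h₁ h₃ r₁≡r₃
           (inj₂ (inj₂ r₂≡r₃)) → equal-rows x₂≢x₃ h₂ h₃ r₂≡r₃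

    ∣S∩V∣≤4-of-d≡true : ∣ S∩V w ∣ ≤ 4
    ∣S∩V∣≤4-of-d≡true =
      subst (_≤ 4) (sym (∣p∣≡∣p∩q∣+∣p∩∁q∣ (S∩V w) X-side))
        (+≤4-unless-2+3 _ _ ∣S∩X∣≤3 ∣S∩Y∣≤3 ¬2×3 ¬3×2)

  ∣S∩V∣≤4 : ∀ w → ∣ S∩V w ∣ ≤ 4
  ∣S∩V∣≤4 w = ≮⇒≥ λ 4<∣S∩V∣ → case pick₄ (<⇒≤ 4<∣S∩V∣) of λ
    (_ , _ , _ , _ , h₁ , h₂ , h₃ , h₄ , D) →
      <⇒≱ 4<∣S∩V∣ (∣S∩V∣≤4-of-d≡true (proj₁ (quadruple⇒dropsTwo D h₁ h₂ h₃ h₄)))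

  module _ {a} (α : IsAlpha H a) where

    ∣T∣≤α : ∣ T ∣ ≤ a
    ∣T∣≤α = proj₂ α T T-independent

    three⇒∣T∣<α : ∀ {w} → 3 ≤ ∣ S∩V w ∣ → ∣ T ∣ < a
    three⇒∣T∣<α {w} h =
      let (_ , _ , _ , h₁ , h₂ , h₃ , D) = pick₃ {p = S∩V w} h
      in critical⇒∣T∣<α H α T-independent (I-crit X _ _) (triple-avoids D h₁ h₂ h₃)

    four⇒∣T∣+2≤α : ∀ {w} → 4 ≤ ∣ S∩V w ∣ → ∣ T ∣ + 2 ≤ a
    four⇒∣T∣+2≤α {w} h =
      let (_ , _ , _ , _ , h₁ , h₂ , h₃ , h₄ , D) = pick₄ {p = S∩V w} h
          (d≡true , T-avoids) = quadruple⇒dropsTwo D h₁ h₂ h₃ h₄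
      in dropsTwo⇒∣T∣+2≤α H α T-independent (Equivalence.to (d-spec X w) d≡true) T-avoids

    ∣S∩V∣+∣T∣≤2+α : ∀ w → ∣ S∩V w ∣ + ∣ T ∣ ≤ 2 + a
    ∣S∩V∣+∣T∣≤2+α w = fiber-slack _ (∣S∩V∣≤4 w) ∣T∣≤α three⇒∣T∣<α four⇒∣T∣+2≤α

    ∣S∣≤α+1 : ∣ S ∣ ≤ a + 1
    ∣S∣≤α+1 with collision? (part X) S
    ... | no no-collision =
      ≤-trans (injective⇒∣p∣≤∣q∣ (part X) (∈-image⁺ (part X)) injective) (≤-trans ∣T∣≤α (m≤m+n a 1))
      where
      injective : ∀ {x y} → x ∈ S → y ∈ S → part X x ≡ part X y → x ≡ y
      injective {x} {y} x∈S y∈S px≡py =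
        decidable-stable (x ≟ᶠ y) λ x≢y → no-collision (x , y , x∈S , y∈S , x≢y , px≡py)
    ... | yes (s₁ , s₂ , s₁∈S , s₂∈S , s₁≢s₂ , ps₁≡ps₂) =
      subst (_≤ a + 1) (sym (∣p∣≡∣p∩q∣+∣p∩∁q∣ S (V w)))
        (+-≤-of-slack ∣ S∩V w ∣ (∣S∖V∣<∣T∣ s₁≢s₂ (∈S∩V⁺ s₁∈S refl) (∈S∩V⁺ s₂∈S (sym ps₁≡ps₂)))
                               (∣S∩V∣+∣T∣≤2+α w))
      where
      w : Fin n
      w = part X s₁

proposition1 : ∀ {n} (H : Graph4 n) (X : Expansion H) (a b : ℕ) →
    IsAlpha H a → IsAlpha (graph X) b → b ≤ a + 1
proposition1 H X a b α ((S , S-indep , refl) , _) = ∣S∣≤α+1 X S-indep α
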